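{- Let $q$ be a prime power, $n\ge1$, and $\alpha\in\mathbb{F}_{q^n}$. The $\mathbb{F}_q$-order of $\alpha$ and the $\mathbb{F}_q$-order of its associated additive character $\chi_\alpha$ coincide if and only if one of them is self-reciprocal.
   Context: Let $q=p^s$ with $p$ prime. $\mathbb{F}_{q^n}$ is an $\mathbb{F}_q[x]$-module via $g\circ\alpha=\sum_{i} b_i\alpha^{q^i}$ for $g(x)=\sum_i b_i x^i\in\mathbb{F}_q[x]$. The $\mathbb{F}_q$-order of $\alpha\in\mathbb{F}_{q^n}$ is the monic generator of the ideal $\{g\in\mathbb{F}_q[x]: g\circ\alpha=0\}$ (a divisor of $x^n-1$). For $a\in\mathbb{F}_{q^n}$, $\chi_a(\beta)=\exp\left(2\pi i\,\mathrm{Tr}_{q^n/p}(a\beta)/p\right)$ with $\mathrm{Tr}_{q^n/p}(x)=\sum_{i=0}^{ns-1}x^{p^i}$; $\chi_0$ is the trivial character. Additive characters form an $\mathbb{F}_q[x]$-module via $(g\circ\chi)(\beta)=\chi(g\circ\beta)$, and the $\mathbb{F}_q$-order of a character $\chi$ is the monic generator of $\{g\in\mathbb{F}_q[x]: g\circ\chi=\chi_0\}$. A monic polynomial $f\in\mathbb{F}_q[x]$ of degree $t$ with $f(0)\neq0$ is self-reciprocal if $f^*(x):=f(0)^{ -1}x^t f(1/x)$ equals $f(x)$. -}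

module Defs where

open import Level using (0ℓ)
open import Data.Nat as ℕ using (ℕ; zero; suc; _≥_)
open import Data.Nat.Primality using (Prime)
open import Data.Fin using (Fin)
open import Data.List using (List; []; _∷_; length; reverse; map; zipWith; foldr; sum; upTo; last; head)
open import Data.Maybe using (Maybe; just; nothing)
open import Data.List.Relation.Unary.All using (All)
open import Data.List.Relation.Binary.Pointwise using (Pointwise)
open import Data.Product using (Σ; _×_; ∃)
open import Data.Sum using (_⊎_)
open import Data.Unit using (⊤)
open import Relation.Nullary using (¬_)
open import Relation.Binary.PropositionalEquality using (_≡_)
import Relation.Binary.PropositionalEquality as ≡
open import Function.Bundles using (Inverse)
open import Algebra.Bundles using (CommutativeRing)

-- A finite field of characteristic p with exactly N elements.
-- (Up to isomorphism, for N = q^n with q = p^s, this is F_{q^n}.)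

natR : (R : CommutativeRing 0ℓ 0ℓ) → ℕ → CommutativeRing.Carrier R
natR R zero    = CommutativeRing.0# R
natR R (suc k) = CommutativeRing._+_ R (CommutativeRing.1# R) (natR R k)

record FiniteField (p N : ℕ) : Set₁ where
  field
    cring : CommutativeRing 0ℓ 0ℓ
  open CommutativeRing cring public

  field
    _⁻¹        : Carrier → Carrier
    inverseʳ   : ∀ x → ¬ (x ≈ 0#) → x * (x ⁻¹) ≈ 1#
    1≉0        : ¬ (1# ≈ 0#)
    char-p     : natR cring p ≈ 0#
    enumerate  : Inverse (≡.setoid (Fin N)) setoid

module FqnTheory (p s n : ℕ) (K : FiniteField p ((p ℕ.^ s) ℕ.^ n)) where
  open FiniteField K

  q : ℕ
  q = p ℕ.^ s

  pow : Carrier → ℕ → Carrier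
  pow x zero    = 1#
  pow x (suc k) = x * pow x k

  frobq : ℕ → Carrier → Carrier
  frobq i x = pow x (q ℕ.^ i)

  InFq : Carrier → Set
  InFq x = pow x q ≈ x

  -- polynomials over F_q: coefficient lists [b_0, b_1, …, b_t]
  -- (lowest degree first) with all coefficients in F_q
  Poly : Set
  Poly = Σ (List Carrier) (All InFq)

  coeffs : Poly → List Carrier
  coeffs = Data.Product.proj₁

  -- evaluation of the F_q[x]-action: g ∘ α = Σ_i b_i α^{q^i}
  actL : ℕ → List Carrier → Carrier → Carrier
  actL i []       α = 0#
  actL i (b ∷ bs) α = b * frobq i α + actL (suc i) bs α

  _∘ₚ_ : Poly → Carrier → Carrier
  g ∘ₚ α = actL 0 (coeffs g) α

  addL : List Carrier → List Carrier → List Carrier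
  addL []       ys       = ys
  addL xs       []       = xs
  addL (x ∷ xs) (y ∷ ys) = (x + y) ∷ addL xs ys

  scaleL : Carrier → List Carrier → List Carrier
  scaleL c = map (c *_)

  mulL : List Carrier → List Carrier → List Carrier
  mulL []       ys = []
  mulL (x ∷ xs) ys = addL (scaleL x ys) (0# ∷ mulL xs ys)

  -- equality of polynomials: coefficientwise, trailing zeros ignored
  PolyEqL : List Carrier → List Carrier → Set
  PolyEqL []       []       = ⊤
  PolyEqL []       (y ∷ ys) = (0# ≈ y) × PolyEqL [] ys
  PolyEqL (x ∷ xs) []       = (x ≈ 0#) × PolyEqL xs []
  PolyEqL (x ∷ xs) (y ∷ ys) = (x ≈ y) × PolyEqL xs ys

  _≈ₚ_ : Poly → Poly → Set
  f ≈ₚ g = PolyEqL (coeffs f) (coeffs g)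

  _∣ₚ_ : Poly → Poly → Set
  f ∣ₚ g = Σ Poly λ k → PolyEqL (coeffs g) (mulL (coeffs f) (coeffs k))

  Monic : Poly → Set
  Monic f = Σ Carrier λ c → (last (coeffs f) ≡ just c) × (c ≈ 1#)

  -- degree of a monic polynomial (no trailing zeros since last coeff is 1)
  deg : Poly → ℕ
  deg f = length (coeffs f) ℕ.∸ 1

  const : Poly → Carrier
  const f with coeffs f
  ... | []    = 0#
  ... | c ∷ _ = c

  -- reciprocal f*(x) = f(0)^{-1} x^t f(1/x): coefficient list reversed, scaled
  reciprocalL : Poly → List Carrier
  reciprocalL f = scaleL (const f ⁻¹) (reverse (coeffs f))

  SelfReciprocal : Poly → Set
  SelfReciprocal f = Monic f × ¬ (const f ≈ 0#) × PolyEqL (reciprocalL f) (coeffs f)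

  IsFqOrder : Carrier → Poly → Set
  IsFqOrder α g = Monic g × (g ∘ₚ α ≈ 0#) × (∀ h → h ∘ₚ α ≈ 0# → g ∣ₚ h)

  trace : Carrier → Carrier
  trace x = foldr (λ i acc → pow x (p ℕ.^ i) + acc) 0# (upTo (n ℕ.* s))

  -- Additive characters. χ_a(β) = exp(2πi Tr(aβ)/p), where Tr(aβ) ∈ F_p.
  -- Since t ↦ exp(2πi t/p) is an isomorphism from (F_p,+) onto the p-th roots
  -- of unity, we represent the character value by its "logarithm" Tr(aβ) ∈ F_p ⊆ K;
  -- a character χ is then a function K → K, and χ = χ₀ iff it is identically 0.
  Character : Set
  Character = Carrier → Carrier

  χ : Carrier → Character
  χ a β = trace (a * β)

  _∘χ_ : Poly → Character → Character
  (g ∘χ c) β = c (g ∘ₚ β)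

  IsTrivial : Character → Set
  IsTrivial c = ∀ β → c β ≈ 0#

  IsCharFqOrder : Character → Poly → Set
  IsCharFqOrder c g = Monic g × IsTrivial (g ∘χ c) × (∀ h → IsTrivial (h ∘χ c) → g ∣ₚ h)

{-# OPTIONS --safe #-}
module Submission where

-- For f ∈ F_q[x] with t coefficients, invariance of the trace under Frobenius gives
--   Tr (α · (f ∘ β)) = Tr (β ^ q ^ t · (rev f ∘ α) ^ q),
-- rev f being f with its coefficient list reversed.  The trace form is nondegenerate and
-- Frobenius is onto, so f kills χ_α exactly when rev f kills α.  Both orders divide
-- x ^ n - 1 and so have nonzero constant terms.  As rev g* is a scalar multiple of g, the
-- reciprocal g* kills χ_α and h ∣ g*; as h* is a scalar multiple of rev h, it kills α and
-- g ∣ h*.  Comparing degrees, these are divisions between monic polynomials of equal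
-- degree, so h = g* and g = h*, whence g = h iff g = g* iff h = h*.

open import Level using (0ℓ)
open import Data.Nat using (ℕ; zero; suc; _^_; _≥_; _≤_; _<_; z≤n; s≤s; _!)
import Data.Nat as ℕ
import Data.Nat.Properties as ℕ
open import Data.Nat.Combinatorics using (_C_; nCn≡1; nCk≡n!/k![n-k]!; k![n∸k]!∣n!)
open import Data.Nat.Divisibility using (_∣_; _∤_; divides; ∣1⇒≡1; ∣⇒≤; m∣m*n)
open import Data.Nat.DivMod using (m/n*n≡m)
open import Data.Nat.Primality using (Prime; euclidsLemma; ¬prime[1]; prime⇒nonZero; prime⇒nonTrivial)
open import Data.Empty using (⊥; ⊥-elim)
open import Data.Unit using (tt)
open import Data.Product using (∃; _×_; _,_; proj₁; proj₂)
open import Data.Sum using (_⊎_; inj₁; inj₂; [_,_]′)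
open import Data.Maybe using (just)
open import Data.Fin using (Fin; punchIn; punchOut; toℕ; fromℕ; inject₁)
import Data.Fin.Properties as Fin
open import Data.Fin.Permutation using (Permutation; permutation)
open import Data.Vec.Functional using (tail)
open import Data.List using (List; []; _∷_; _∷ʳ_; length; reverse; map; foldr; _++_; upTo; last)
open import Data.List.Properties
  using (map-applyUpTo; upTo-∷ʳ; unfold-reverse; length-map; length-reverse; reverse-map; reverse-involutive)
open import Data.List.Relation.Unary.All using (All; []; _∷_)
import Data.List.Relation.Unary.All as All
open import Data.List.Relation.Unary.All.Properties using (map⁺)
open import Data.List.Relation.Binary.Permutation.Propositional using (↭-sym)
open import Data.List.Relation.Binary.Permutation.Propositional.Properties using (All-resp-↭; ↭-reverse)
open import Function using (_∘_; id)
open import Function.Bundles using (_⇔_; mk⇔; Inverse; module Equivalence)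
open import Relation.Nullary using (¬_; yes; no)
open import Relation.Binary using (Decidable; Setoid)
import Relation.Binary.PropositionalEquality as ≡
open ≡ using (_≡_)
import Algebra.Properties.CommutativeMonoid.Sum
open import Defs

-- Binomial coefficients modulo a prime

module _ {p : ℕ} (p-prime : Prime p) where

  prime∤! : ∀ {m} → m < p → p ∤ m !
  prime∤! {zero}  _   p∣1 = ¬prime[1] (≡.subst Prime (∣1⇒≡1 p∣1) p-prime)
  prime∤! {suc m} m<p p∣m! with euclidsLemma (suc m) (m !) p-prime p∣m!
  ... | inj₁ p∣1+m = ℕ.<⇒≱ m<p (∣⇒≤ p∣1+m)
  ... | inj₂ p∣m!  = prime∤! (ℕ.<-trans (ℕ.n<1+n m) m<p) p∣m!

  prime∣C : ∀ {k} → 0 < k → k < p → p ∣ p C k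
  prime∣C {k} 0<k k<p =
    [ id , ⊥-elim ∘ p∤k!*[p∸k]! ]′ (euclidsLemma (p C k) (k ! ℕ.* (p ℕ.∸ k) !) p-prime p∣C*k!*[p∸k]!)
    where
    instance
      _ = ℕ._!*_!≢0 k (p ℕ.∸ k)
      _ = prime⇒nonZero p-prime
    p∣p! : p ∣ p !
    p∣p! = ≡.subst (λ m → m ∣ m !) (ℕ.suc-pred p) (m∣m*n (ℕ.pred p !))
    p∣C*k!*[p∸k]! : p ∣ (p C k) ℕ.* (k ! ℕ.* (p ℕ.∸ k) !)
    p∣C*k!*[p∸k]! = ≡.subst (p ∣_) (≡.sym (≡.trans
      (≡.cong (ℕ._* (k ! ℕ.* (p ℕ.∸ k) !)) (nCk≡n!/k![n-k]! (ℕ.<⇒≤ k<p)))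
      (m/n*n≡m (k![n∸k]!∣n! (ℕ.<⇒≤ k<p))))) p∣p!
    p∤k!*[p∸k]! : p ∤ k ! ℕ.* (p ℕ.∸ k) !
    p∤k!*[p∸k]! p∣ = [ prime∤! k<p , prime∤! (ℕ.∸-monoʳ-< 0<k (ℕ.<⇒≤ k<p)) ]′ (euclidsLemma (k !) _ p-prime p∣)

-- Finite fields

module FiniteFieldProperties {p N : ℕ} (F : FiniteField p N) where
  open FiniteField F
  open import Algebra.Properties.Semiring.Exp semiring
    using (^-congˡ; ^-assocʳ) renaming (_^_ to _^ᴷ_)
  open import Algebra.Properties.CommutativeSemigroup *-commutativeSemigroup using (x∙yz≈y∙xz)
  open import Algebra.Properties.Group +-group
    using (x∙y⁻¹≈ε⇒x≈y; inverseʳ-unique; ⁻¹-involutive; ε⁻¹≈ε) renaming (∙-cancelˡ to +-cancelˡ)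
  open import Relation.Binary.Reasoning.Setoid setoid

  module Enum = Inverse enumerate

  _≟_ : Decidable _≈_
  x ≟ y with Enum.from x Fin.≟ Enum.from y
  ... | yes i≡j = yes (begin
    x                  ≈⟨ Enum.strictlyInverseˡ x ⟨
    Enum.to (Enum.from x) ≡⟨ ≡.cong Enum.to i≡j ⟩
    Enum.to (Enum.from y) ≈⟨ Enum.strictlyInverseˡ y ⟩
    y                  ∎)
  ... | no i≢j  = no (i≢j ∘ Enum.from-cong)

  x⁻¹*x≈1 : ∀ {x} → x ≉ 0# → x ⁻¹ * x ≈ 1#
  x⁻¹*x≈1 {x} x≉0 = trans (*-comm _ _) (inverseʳ x x≉0)

  *-cancelʳ : ∀ {x y z} → z ≉ 0# → x * z ≈ y * z → x ≈ y
  *-cancelʳ {x} {y} {z} z≉0 xz≈yz = begin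
    x                ≈⟨ *-identityʳ x ⟨
    x * 1#           ≈⟨ *-congˡ (inverseʳ z z≉0) ⟨
    x * (z * z ⁻¹)   ≈⟨ *-assoc x z _ ⟨
    (x * z) * z ⁻¹   ≈⟨ *-congʳ xz≈yz ⟩
    (y * z) * z ⁻¹   ≈⟨ *-assoc y z _ ⟩
    y * (z * z ⁻¹)   ≈⟨ *-congˡ (inverseʳ z z≉0) ⟩
    y * 1#           ≈⟨ *-identityʳ y ⟩
    y                ∎

  x*y≉0 : ∀ {x y} → x ≉ 0# → y ≉ 0# → x * y ≉ 0#
  x*y≉0 {x} {y} x≉0 y≉0 xy≈0 = y≉0 (*-cancelʳ x≉0 (begin
    y * x  ≈⟨ *-comm y x ⟩
    x * y  ≈⟨ xy≈0 ⟩
    0#     ≈⟨ zeroˡ x ⟨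
    0# * x ∎))

  x*y≈0⇒x≈0⊎y≈0 : ∀ {x y} → x * y ≈ 0# → x ≈ 0# ⊎ y ≈ 0#
  x*y≈0⇒x≈0⊎y≈0 {x} {y} xy≈0 with x ≟ 0# | y ≟ 0#
  ... | yes x≈0 | _       = inj₁ x≈0
  ... | no _    | yes y≈0 = inj₂ y≈0
  ... | no x≉0  | no y≉0  = ⊥-elim (x*y≉0 x≉0 y≉0 xy≈0)

  x⁻¹≉0 : ∀ {x} → x ≉ 0# → x ⁻¹ ≉ 0#
  x⁻¹≉0 {x} x≉0 x⁻¹≈0 = 1≉0 (begin
    1#        ≈⟨ inverseʳ x x≉0 ⟨
    x * x ⁻¹  ≈⟨ *-congˡ x⁻¹≈0 ⟩
    x * 0#    ≈⟨ zeroʳ x ⟩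
    0#        ∎)

  x^k≉0 : ∀ {x} k → x ≉ 0# → x ^ᴷ k ≉ 0#
  x^k≉0 zero    _   = 1≉0
  x^k≉0 (suc k) x≉0 = x*y≉0 x≉0 (x^k≉0 k x≉0)

  -x≈0⇒x≈0 : ∀ {x} → - x ≈ 0# → x ≈ 0#
  -x≈0⇒x≈0 {x} -x≈0 = trans (sym (⁻¹-involutive x)) (trans (-‿cong -x≈0) ε⁻¹≈ε)

  +-homo⇒0-homo : (f : Carrier → Carrier) → (∀ {x y} → x ≈ y → f x ≈ f y) →
                  (∀ x y → f (x + y) ≈ f x + f y) → f 0# ≈ 0#
  +-homo⇒0-homo f f-cong f-+ = +-cancelˡ (f 0#) _ _ (begin
    f 0# + f 0#   ≈⟨ f-+ 0# 0# ⟨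
    f (0# + 0#)   ≈⟨ f-cong (+-identityʳ 0#) ⟩
    f 0#          ≈⟨ +-identityʳ _ ⟨
    f 0# + 0#     ∎)

  +-homo⇒-‿homo : (f : Carrier → Carrier) → (∀ {x y} → x ≈ y → f x ≈ f y) →
                  (∀ x y → f (x + y) ≈ f x + f y) → ∀ x → f (- x) ≈ - f x
  +-homo⇒-‿homo f f-cong f-+ x = inverseʳ-unique (f x) (f (- x)) (begin
    f x + f (- x)  ≈⟨ f-+ x (- x) ⟨
    f (x - x)      ≈⟨ f-cong (-‿inverseʳ x) ⟩
    f 0#           ≈⟨ +-homo⇒0-homo f f-cong f-+ ⟩
    0#             ∎)

  module ∏ = Algebra.Properties.CommutativeMonoid.Sum *-commutativeMonoid
    renaming (sum to ∏)
  open ∏ using (∏)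

  ∏-≉0 : ∀ {m} (f : Fin m → Carrier) → (∀ i → f i ≉ 0#) → ∏ f ≉ 0#
  ∏-≉0 {zero}  f f≉0 = 1≉0
  ∏-≉0 {suc m} f f≉0 = x*y≉0 (f≉0 Fin.zero) (∏-≉0 (f ∘ Fin.suc) (f≉0 ∘ Fin.suc))

  ∏-scale : ∀ {m} x (f : Fin m → Carrier) → ∏ (λ i → x * f i) ≈ x ^ᴷ m * ∏ f
  ∏-scale {m} x f = trans (∏.∑-distrib-+ (λ _ → x) f) (*-congʳ (∏.sum-replicate m))

  -- Multiplication by a unit permutes the units, so x ^ M * ∏ unit ≈ ∏ unit.
  module Units {M : ℕ} (enum : Inverse (≡.setoid (Fin (suc M))) setoid) where
    private module E = Inverse enum

    unit : Fin M → Carrier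
    unit j = E.to (punchIn (E.from 0#) j)

    unit≉0 : ∀ j → unit j ≉ 0#
    unit≉0 j unitj≈0 = Fin.punchInᵢ≢i (E.from 0#) j
      (≡.trans (≡.sym (E.strictlyInverseʳ _)) (E.from-cong unitj≈0))

    index : ∀ {y} → y ≉ 0# → Fin M
    index {y} y≉0 = punchOut {i = E.from 0#} {j = E.from y} λ 0≡y → y≉0 (begin
      y                    ≈⟨ E.strictlyInverseˡ y ⟨
      E.to (E.from y)      ≡⟨ ≡.cong E.to 0≡y ⟨
      E.to (E.from 0#)     ≈⟨ E.strictlyInverseˡ 0# ⟩
      0#                   ∎)

    unit-index : ∀ {y} (y≉0 : y ≉ 0#) → unit (index y≉0) ≈ y
    unit-index {y} y≉0 = trans (E.to-cong (Fin.punchIn-punchOut _)) (E.strictlyInverseˡ y)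

    index-unique : ∀ {y} (y≉0 : y ≉ 0#) {j} → unit j ≈ y → index y≉0 ≡ j
    index-unique y≉0 {j} unitj≈y = ≡.trans
      (Fin.punchOut-cong′ (E.from 0#) (≡.trans (≡.sym (E.from-cong unitj≈y)) (E.strictlyInverseʳ _)))
      (Fin.punchOut-punchIn (E.from 0#))

    scaleIndex : ∀ {x} → x ≉ 0# → Fin M → Fin M
    scaleIndex x≉0 j = index (x*y≉0 x≉0 (unit≉0 j))

    unit-scaleIndex : ∀ {x} (x≉0 : x ≉ 0#) j → unit (scaleIndex x≉0 j) ≈ x * unit j
    unit-scaleIndex x≉0 j = unit-index (x*y≉0 x≉0 (unit≉0 j))

    scaleIndex-inverse : ∀ {x y} (x≉0 : x ≉ 0#) (y≉0 : y ≉ 0#) → x * y ≈ 1# →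
                         ∀ j → scaleIndex x≉0 (scaleIndex y≉0 j) ≡ j
    scaleIndex-inverse {x} {y} x≉0 y≉0 xy≈1 j = index-unique (x*y≉0 x≉0 (unit≉0 _)) (sym (begin
      x * unit (scaleIndex y≉0 j) ≈⟨ *-congˡ (unit-scaleIndex y≉0 j) ⟩
      x * (y * unit j)            ≈⟨ *-assoc x y _ ⟨
      (x * y) * unit j            ≈⟨ *-congʳ xy≈1 ⟩
      1# * unit j                 ≈⟨ *-identityˡ _ ⟩
      unit j                      ∎))

    scaling : ∀ {x} → x ≉ 0# → Permutation M M
    scaling {x} x≉0 = permutation (scaleIndex x≉0) (scaleIndex (x⁻¹≉0 x≉0))
      (scaleIndex-inverse x≉0 (x⁻¹≉0 x≉0) (inverseʳ x x≉0))
      (scaleIndex-inverse (x⁻¹≉0 x≉0) x≉0 (x⁻¹*x≈1 x≉0))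

    x^M≈1 : ∀ {x} → x ≉ 0# → x ^ᴷ M ≈ 1#
    x^M≈1 {x} x≉0 = *-cancelʳ (∏-≉0 unit unit≉0) (begin
      x ^ᴷ M * ∏ unit             ≈⟨ ∏-scale x unit ⟨
      ∏ (λ j → x * unit j)        ≈⟨ ∏.sum-cong-≋ (unit-scaleIndex x≉0) ⟨
      ∏ (unit ∘ scaleIndex x≉0)   ≈⟨ ∏.sum-permute unit (scaling x≉0) ⟨
      ∏ unit                      ≈⟨ *-identityˡ _ ⟨
      1# * ∏ unit                 ∎)

  x^size≈x : ∀ {m} → Inverse (≡.setoid (Fin m)) setoid → ∀ x → x ^ᴷ m ≈ x
  x^size≈x {zero} enum x with Inverse.from enum x
  ... | ()
  x^size≈x {suc M} enum x with x ≟ 0#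
  ... | yes x≈0 = trans (^-congˡ (suc M) x≈0) (trans (zeroˡ _) (sym x≈0))
  ... | no x≉0  = trans (*-congˡ (Units.x^M≈1 enum x≉0)) (*-identityʳ x)

  fermat : ∀ x → x ^ᴷ N ≈ x
  fermat = x^size≈x enumerate

  module _ (p-prime : Prime p) where
    open import Algebra.Properties.Semiring.Mult semiring using (×-congʳ; ×-assoc-*; ×-assocˡ)
      renaming (_×_ to _·_)
    open import Algebra.Properties.CommutativeSemiring.Binomial commutativeSemiring
      using (binomialTerm; theorem)
    open import Algebra.Properties.Semiring.Sum semiring using (sum; sum-init-last; sum-cong-≋; sum-replicate-zero)

    natR≡·1# : ∀ k → natR cring k ≡ k · 1#
    natR≡·1# zero    = ≡.refl
    natR≡·1# (suc k) = ≡.cong (1# +_) (natR≡·1# k)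

    p·x≈0 : ∀ x → p · x ≈ 0#
    p·x≈0 x = begin
      p · x          ≈⟨ ×-congʳ p (*-identityˡ x) ⟨
      p · (1# * x)   ≈⟨ ×-assoc-* p 1# x ⟨
      (p · 1#) * x   ≡⟨ ≡.cong (_* x) (natR≡·1# p) ⟨
      natR cring p * x ≈⟨ *-congʳ char-p ⟩
      0# * x         ≈⟨ zeroˡ x ⟩
      0#             ∎

    p∣m⇒m·x≈0 : ∀ {m} → p ∣ m → ∀ x → m · x ≈ 0#
    p∣m⇒m·x≈0 (divides d ≡.refl) x = begin
      (d ℕ.* p) · x  ≡⟨ ≡.cong (_· x) (ℕ.*-comm d p) ⟩
      (p ℕ.* d) · x  ≈⟨ ×-assocˡ x p d ⟨
      p · (d · x)    ≈⟨ p·x≈0 (d · x) ⟩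
      0#             ∎

    -- Only the two outer terms of the binomial expansion of (x + y) ^ p survive.
    freshman : ∀ x y → (x + y) ^ᴷ p ≈ x ^ᴷ p + y ^ᴷ p
    freshman x y = expand (ℕ.suc-pred p)
      where
      instance _ = prime⇒nonZero p-prime
      expand : ∀ {m} → suc m ≡ p → (x + y) ^ᴷ p ≈ x ^ᴷ p + y ^ᴷ p
      expand {m} ≡.refl = begin
        (x + y) ^ᴷ p                            ≈⟨ theorem p x y ⟩
        t Fin.zero + sum (tail t)               ≈⟨ +-congˡ (sum-init-last (tail t)) ⟩
        t Fin.zero + (sum inner + t (fromℕ p))  ≈⟨ +-congˡ (+-congʳ inner≈0) ⟩
        t Fin.zero + (0# + t (fromℕ p))         ≈⟨ +-cong initial (+-identityˡ _) ⟩
        y ^ᴷ p + t (fromℕ p)                    ≈⟨ +-comm _ _ ⟩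
        t (fromℕ p) + y ^ᴷ p                    ≈⟨ +-congʳ final ⟩
        x ^ᴷ p + y ^ᴷ p                         ∎
        where
        t = binomialTerm x y p
        inner : Fin m → Carrier
        inner i = t (Fin.suc (inject₁ i))
        inner≈0 : sum inner ≈ 0#
        inner≈0 = trans (sum-cong-≋ λ i → p∣m⇒m·x≈0 (prime∣C p-prime (s≤s z≤n) (s≤s (toℕ-inject₁<m i))) _)
                        (sum-replicate-zero m)
          where
          toℕ-inject₁<m : (i : Fin m) → toℕ (inject₁ i) < m
          toℕ-inject₁<m i = ≡.subst (_< m) (≡.sym (Fin.toℕ-inject₁ i)) (Fin.toℕ<n i)
        initial : t Fin.zero ≈ y ^ᴷ p
        initial = trans (+-identityʳ _) (*-identityˡ _)
        final : t (fromℕ p) ≈ x ^ᴷ p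
        final = begin
          t (fromℕ p)                         ≡⟨ ≡.cong (λ k → (p C k) · (x ^ᴷ k * y ^ᴷ (p ℕ.∸ k))) (Fin.toℕ-fromℕ p) ⟩
          (p C p) · (x ^ᴷ p * y ^ᴷ (p ℕ.∸ p)) ≡⟨ ≡.cong₂ (λ c e → c · (x ^ᴷ p * y ^ᴷ e)) (nCn≡1 p) (ℕ.n∸n≡0 p) ⟩
          1 · (x ^ᴷ p * 1#)                   ≈⟨ +-identityʳ _ ⟩
          x ^ᴷ p * 1#                         ≈⟨ *-identityʳ _ ⟩
          x ^ᴷ p                              ∎

    freshman-^ : ∀ k x y → (x + y) ^ᴷ (p ℕ.^ k) ≈ x ^ᴷ (p ℕ.^ k) + y ^ᴷ (p ℕ.^ k)
    freshman-^ zero    x y = trans (*-identityʳ _) (sym (+-cong (*-identityʳ x) (*-identityʳ y)))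
    freshman-^ (suc k) x y = begin
      (x + y) ^ᴷ (p ℕ.* p ℕ.^ k)              ≈⟨ ^-assocʳ (x + y) p _ ⟨
      ((x + y) ^ᴷ p) ^ᴷ (p ℕ.^ k)             ≈⟨ ^-congˡ (p ℕ.^ k) (freshman x y) ⟩
      (x ^ᴷ p + y ^ᴷ p) ^ᴷ (p ℕ.^ k)          ≈⟨ freshman-^ k _ _ ⟩
      (x ^ᴷ p) ^ᴷ (p ℕ.^ k) + (y ^ᴷ p) ^ᴷ (p ℕ.^ k) ≈⟨ +-cong (^-assocʳ x p _) (^-assocʳ y p _) ⟩
      x ^ᴷ (p ℕ.* p ℕ.^ k) + y ^ᴷ (p ℕ.* p ℕ.^ k) ∎

  -- Coefficient lists start with the constant term, so the leading coefficient is the last entry.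
  LeadingCoeff : List Carrier → Carrier → Set
  LeadingCoeff []           _ = ⊥
  LeadingCoeff (c ∷ [])     b = c ≈ b
  LeadingCoeff (_ ∷ c ∷ cs) b = LeadingCoeff (c ∷ cs) b

  LeadingCoeff-resp : ∀ cs {a b} → a ≈ b → LeadingCoeff cs a → LeadingCoeff cs b
  LeadingCoeff-resp (c ∷ [])     a≈b c≈a = trans c≈a a≈b
  LeadingCoeff-resp (_ ∷ c ∷ cs) a≈b lead = LeadingCoeff-resp (c ∷ cs) a≈b lead

  LeadingCoeff-∷ : ∀ c cs {b} → LeadingCoeff cs b → LeadingCoeff (c ∷ cs) b
  LeadingCoeff-∷ _ (_ ∷ _) lead = lead

  LeadingCoeff-∷ʳ : ∀ cs b → LeadingCoeff (cs ∷ʳ b) b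
  LeadingCoeff-∷ʳ []       b = refl
  LeadingCoeff-∷ʳ (c ∷ cs) b = LeadingCoeff-∷ c (cs ∷ʳ b) (LeadingCoeff-∷ʳ cs b)

  LeadingCoeff-reverse : ∀ c cs → LeadingCoeff (reverse (c ∷ cs)) c
  LeadingCoeff-reverse c cs =
    ≡.subst (λ L → LeadingCoeff L c) (≡.sym (unfold-reverse c cs)) (LeadingCoeff-∷ʳ (reverse cs) c)

  LeadingCoeff-map-* : ∀ a cs {b} → LeadingCoeff cs b → LeadingCoeff (map (a *_) cs) (a * b)
  LeadingCoeff-map-* a (c ∷ [])     c≈b  = *-congˡ c≈b
  LeadingCoeff-map-* a (_ ∷ c ∷ cs) lead = LeadingCoeff-map-* a (c ∷ cs) lead

  last≡just⇒LeadingCoeff : ∀ cs {b} → last cs ≡ just b → LeadingCoeff cs b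
  last≡just⇒LeadingCoeff (c ∷ [])     ≡.refl = refl
  last≡just⇒LeadingCoeff (_ ∷ c ∷ cs) eq     = last≡just⇒LeadingCoeff (c ∷ cs) eq

  eval : List Carrier → Carrier → Carrier
  eval []       _ = 0#
  eval (c ∷ cs) x = c + x * eval cs x

  eval-[c] : ∀ c x → eval (c ∷ []) x ≈ c
  eval-[c] c x = trans (+-congˡ (zeroʳ x)) (+-identityʳ c)

  -- Synthetic division: the quotient of cs by (x - a).
  divideBy : List Carrier → Carrier → List Carrier
  divideBy []            _ = []
  divideBy (_ ∷ [])      _ = []
  divideBy (_ ∷ c ∷ cs)  a = eval (c ∷ cs) a ∷ divideBy (c ∷ cs) a

  eval-divideBy : ∀ cs a x → eval cs x ≈ eval cs a + (x - a) * eval (divideBy cs a) x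
  eval-divideBy []           a x = sym (trans (+-congˡ (zeroʳ _)) (+-identityʳ _))
  eval-divideBy (c ∷ [])     a x = trans (eval-[c] c x) (sym (trans (+-cong (eval-[c] c a) (zeroʳ _)) (+-identityʳ c)))
  eval-divideBy (c ∷ c′ ∷ cs) a x = begin
    c + x * f x                                ≈⟨ +-congˡ (*-congˡ (eval-divideBy (c′ ∷ cs) a x)) ⟩
    c + x * (f a + (x - a) * q x)              ≈⟨ +-congˡ (distribˡ x (f a) _) ⟩
    c + (x * f a + x * ((x - a) * q x))        ≈⟨ +-congˡ (+-cong (sym split) (x∙yz≈y∙xz x (x - a) (q x))) ⟩
    c + ((a * f a + (x - a) * f a) + (x - a) * (x * q x)) ≈⟨ +-congˡ (+-assoc _ _ _) ⟩
    c + (a * f a + ((x - a) * f a + (x - a) * (x * q x))) ≈⟨ +-assoc _ _ _ ⟨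
    (c + a * f a) + ((x - a) * f a + (x - a) * (x * q x)) ≈⟨ +-congˡ (distribˡ (x - a) (f a) _) ⟨
    (c + a * f a) + (x - a) * (f a + x * q x)  ∎
    where
    f = eval (c′ ∷ cs)
    q = eval (divideBy (c′ ∷ cs) a)
    split : a * f a + (x - a) * f a ≈ x * f a
    split = trans (sym (distribʳ (f a) a (x - a))) (*-congʳ (begin
      a + (x - a)   ≈⟨ +-comm a _ ⟩
      (x - a) + a   ≈⟨ +-assoc x (- a) a ⟩
      x + (- a + a) ≈⟨ +-congˡ (-‿inverseˡ a) ⟩
      x + 0#        ≈⟨ +-identityʳ x ⟩
      x             ∎))

  length-divideBy : ∀ c cs a → length (divideBy (c ∷ cs) a) ≡ length cs
  length-divideBy c []        a = ≡.refl
  length-divideBy c (c′ ∷ cs) a = ≡.cong suc (length-divideBy c′ cs a)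

  LeadingCoeff-divideBy : ∀ c c′ cs a {b} → LeadingCoeff (c ∷ c′ ∷ cs) b →
                          LeadingCoeff (divideBy (c ∷ c′ ∷ cs) a) b
  LeadingCoeff-divideBy c c′ []        a c′≈b = trans (eval-[c] c′ a) c′≈b
  LeadingCoeff-divideBy c c′ (c″ ∷ cs) a lead = LeadingCoeff-divideBy c′ c″ cs a lead

  distinctRoots<length : ∀ cs {b} → LeadingCoeff cs b → b ≉ 0# →
                         ∀ {k} (r : Fin k → Carrier) → (∀ {i j} → r i ≈ r j → i ≡ j) →
                         (∀ i → eval cs (r i) ≈ 0#) → k < length cs
  distinctRoots<length (c ∷ cs)     _    _   {zero}  _ _ _ = s≤s z≤n
  distinctRoots<length (c ∷ [])     c≈b  b≉0 {suc k} r _ root =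
    ⊥-elim (b≉0 (trans (sym c≈b) (trans (sym (eval-[c] c (r Fin.zero))) (root Fin.zero))))
  distinctRoots<length (c ∷ c′ ∷ cs) lead b≉0 {suc k} r r-inj root =
    s≤s (≡.subst (k <_) (length-divideBy c (c′ ∷ cs) a)
      (distinctRoots<length Q (LeadingCoeff-divideBy c c′ cs a lead) b≉0
        (r ∘ Fin.suc) (Fin.suc-injective ∘ r-inj) Q-root))
    where
    a = r Fin.zero
    Q = divideBy (c ∷ c′ ∷ cs) a
    factor≈0 : ∀ x → eval (c ∷ c′ ∷ cs) x ≈ 0# → (x - a) * eval Q x ≈ 0#
    factor≈0 x x-root = begin
      (x - a) * eval Q x                             ≈⟨ +-identityˡ _ ⟨
      0# + (x - a) * eval Q x                        ≈⟨ +-congʳ (root Fin.zero) ⟨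
      eval (c ∷ c′ ∷ cs) a + (x - a) * eval Q x      ≈⟨ eval-divideBy (c ∷ c′ ∷ cs) a x ⟨
      eval (c ∷ c′ ∷ cs) x                           ≈⟨ x-root ⟩
      0#                                             ∎
    Q-root : ∀ i → eval Q (r (Fin.suc i)) ≈ 0#
    Q-root i with x*y≈0⇒x≈0⊎y≈0 (factor≈0 _ (root (Fin.suc i)))
    ... | inj₁ r-a≈0 with r-inj (x∙y⁻¹≈ε⇒x≈y _ _ r-a≈0)
    ...   | ()
    Q-root i | inj₂ Q≈0 = Q≈0

-- The field F_{q^n}

module FqnProperties (p s n : ℕ) (p-prime : Prime p) (s≥1 : s ≥ 1) (n≥1 : n ≥ 1)
                     (K : FiniteField p ((p ^ s) ^ n)) where
  open FiniteField K
  open FqnTheory p s n K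
  open FiniteFieldProperties K
  open import Algebra.Properties.Semiring.Exp semiring
    using (^-congˡ; ^-congʳ; ^-assocʳ) renaming (_^_ to _^ᴷ_)
  open import Algebra.Properties.CommutativeSemiring.Exp commutativeSemiring using (^-distrib-*)
  open import Algebra.Properties.Group +-group using () renaming (∙-cancelˡ to +-cancelˡ)
  open import Algebra.Properties.CommutativeSemigroup +-commutativeSemigroup
    using () renaming (interchange to +-interchange)
  open import Algebra.Properties.CommutativeSemigroup *-commutativeSemigroup using (x∙yz≈z∙yx)
  open import Algebra.Properties.Ring ring using (-1*x≈-x)
  open import Relation.Binary.Reasoning.Setoid setoid

  1<p : 1 < p
  1<p = ℕ.nonTrivial⇒n>1 p {{prime⇒nonTrivial p-prime}}

  pow≡^ᴷ : ∀ x k → pow x k ≡ x ^ᴷ k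
  pow≡^ᴷ x zero    = ≡.refl
  pow≡^ᴷ x (suc k) = ≡.cong (x *_) (pow≡^ᴷ x k)

  frobq≈ : ∀ i x → frobq i x ≈ x ^ᴷ (q ^ i)
  frobq≈ i x = reflexive (pow≡^ᴷ x (q ^ i))

  frobq-cong : ∀ i {x y} → x ≈ y → frobq i x ≈ frobq i y
  frobq-cong i {x} {y} x≈y = trans (frobq≈ i x) (trans (^-congˡ (q ^ i) x≈y) (sym (frobq≈ i y)))

  frobq-+ : ∀ i x y → frobq i (x + y) ≈ frobq i x + frobq i y
  frobq-+ i x y = begin
    frobq i (x + y)                               ≈⟨ frobq≈ i (x + y) ⟩
    (x + y) ^ᴷ (q ^ i)                            ≈⟨ ^-congʳ (x + y) q^i≡p^si ⟩
    (x + y) ^ᴷ (p ^ (s ℕ.* i))                    ≈⟨ freshman-^ p-prime (s ℕ.* i) x y ⟩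
    x ^ᴷ (p ^ (s ℕ.* i)) + y ^ᴷ (p ^ (s ℕ.* i))   ≈⟨ +-cong (^-congʳ x q^i≡p^si) (^-congʳ y q^i≡p^si) ⟨
    x ^ᴷ (q ^ i) + y ^ᴷ (q ^ i)                   ≈⟨ +-cong (frobq≈ i x) (frobq≈ i y) ⟨
    frobq i x + frobq i y                         ∎
    where q^i≡p^si = ℕ.^-*-assoc p s i

  frobq-* : ∀ i x y → frobq i (x * y) ≈ frobq i x * frobq i y
  frobq-* i x y = trans (frobq≈ i (x * y))
    (trans (^-distrib-* x y (q ^ i)) (sym (*-cong (frobq≈ i x) (frobq≈ i y))))

  frobq-0 : ∀ i → frobq i 0# ≈ 0#
  frobq-0 i = +-homo⇒0-homo (frobq i) (frobq-cong i) (frobq-+ i)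

  frobq-∘ : ∀ i j x → frobq i (frobq j x) ≈ frobq (i ℕ.+ j) x
  frobq-∘ i j x = begin
    frobq i (frobq j x)        ≈⟨ trans (frobq≈ i _) (^-congˡ (q ^ i) (frobq≈ j x)) ⟩
    (x ^ᴷ (q ^ j)) ^ᴷ (q ^ i)  ≈⟨ ^-assocʳ x (q ^ j) (q ^ i) ⟩
    x ^ᴷ (q ^ j ℕ.* q ^ i)     ≈⟨ ^-congʳ x (≡.trans (ℕ.^-distribˡ-+-* q i j) (ℕ.*-comm (q ^ i) _)) ⟨
    x ^ᴷ (q ^ (i ℕ.+ j))       ≈⟨ frobq≈ (i ℕ.+ j) x ⟨
    frobq (i ℕ.+ j) x          ∎

  InFq⇒frobq1≈ : ∀ {b} → InFq b → frobq 1 b ≈ b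
  InFq⇒frobq1≈ {b} b∈Fq = trans (reflexive (≡.cong (pow b) (ℕ.*-identityʳ q))) b∈Fq

  frobq-InFq : ∀ i {b} → InFq b → frobq i b ≈ b
  frobq-InFq zero    {b} _    = *-identityʳ b
  frobq-InFq (suc i) {b} b∈Fq = begin
    frobq (suc i) b      ≈⟨ frobq-∘ 1 i b ⟨
    frobq 1 (frobq i b)  ≈⟨ frobq-cong 1 (frobq-InFq i b∈Fq) ⟩
    frobq 1 b            ≈⟨ InFq⇒frobq1≈ b∈Fq ⟩
    b                    ∎

  frobq-n : ∀ x → frobq n x ≈ x
  frobq-n x = trans (frobq≈ n x) (fermat x)

  frobq-multiple-of-n : ∀ k x → frobq (k ℕ.* n) x ≈ x
  frobq-multiple-of-n zero    x = *-identityʳ x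
  frobq-multiple-of-n (suc k) x = begin
    frobq (n ℕ.+ k ℕ.* n) x      ≈⟨ frobq-∘ n (k ℕ.* n) x ⟨
    frobq n (frobq (k ℕ.* n) x)  ≈⟨ frobq-n _ ⟩
    frobq (k ℕ.* n) x            ≈⟨ frobq-multiple-of-n k x ⟩
    x                            ∎

  frobq-surjective : ∀ i y → ∃ λ x → frobq i x ≈ y
  frobq-surjective i y = frobq (ℕ.pred n ℕ.* i) y , (begin
    frobq i (frobq (ℕ.pred n ℕ.* i) y)  ≈⟨ frobq-∘ i _ y ⟩
    frobq (suc (ℕ.pred n) ℕ.* i) y      ≡⟨ ≡.cong (λ e → frobq e y) n*i≡i*n ⟩
    frobq (i ℕ.* n) y                   ≈⟨ frobq-multiple-of-n i y ⟩
    y                                   ∎)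
    where
    instance _ = ℕ.>-nonZero n≥1
    n*i≡i*n : suc (ℕ.pred n) ℕ.* i ≡ i ℕ.* n
    n*i≡i*n = ≡.trans (≡.cong (ℕ._* i) (ℕ.suc-pred n)) (ℕ.*-comm n i)

  frobq-≈0 : ∀ i {x} → frobq i x ≈ 0# → x ≈ 0#
  frobq-≈0 i {x} fx≈0 with x ≟ 0#
  ... | yes x≈0 = x≈0
  ... | no x≉0  = ⊥-elim (x^k≉0 (q ^ i) x≉0 (trans (sym (frobq≈ i x)) fx≈0))

  -- The trace

  powerSum : List ℕ → Carrier → Carrier
  powerSum es x = foldr (λ e acc → x ^ᴷ (p ^ e) + acc) 0# es

  powerSum-cong : ∀ es {x y} → x ≈ y → powerSum es x ≈ powerSum es y
  powerSum-cong []       x≈y = refl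
  powerSum-cong (e ∷ es) x≈y = +-cong (^-congˡ (p ^ e) x≈y) (powerSum-cong es x≈y)

  powerSum-+ : ∀ es x y → powerSum es (x + y) ≈ powerSum es x + powerSum es y
  powerSum-+ []       x y = sym (+-identityʳ 0#)
  powerSum-+ (e ∷ es) x y = trans (+-cong (freshman-^ p-prime e x y) (powerSum-+ es x y))
                                  (+-interchange _ _ _ _)

  powerSum-∷ʳ : ∀ es e x → powerSum (es ∷ʳ e) x ≈ powerSum es x + x ^ᴷ (p ^ e)
  powerSum-∷ʳ []        e x = trans (+-identityʳ _) (sym (+-identityˡ _))
  powerSum-∷ʳ (e′ ∷ es) e x = trans (+-congˡ (powerSum-∷ʳ es e x)) (sym (+-assoc _ _ _))

  powerSum-^p : ∀ es x → powerSum es (x ^ᴷ p) ≈ powerSum (map suc es) x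
  powerSum-^p []       x = refl
  powerSum-^p (e ∷ es) x = +-cong (^-assocʳ x p (p ^ e)) (powerSum-^p es x)

  ns : ℕ
  ns = n ℕ.* s

  p^ns≡size : p ^ ns ≡ (p ^ s) ^ n
  p^ns≡size = ≡.trans (≡.cong (p ^_) (ℕ.*-comm n s)) (≡.sym (ℕ.^-*-assoc p s n))

  trace≡powerSum : ∀ x → trace x ≡ powerSum (upTo ns) x
  trace≡powerSum x = go (upTo ns)
    where
    go : ∀ es → foldr (λ e acc → pow x (p ^ e) + acc) 0# es ≡ powerSum es x
    go []       = ≡.refl
    go (e ∷ es) = ≡.cong₂ _+_ (pow≡^ᴷ x (p ^ e)) (go es)

  trace-cong : ∀ {x y} → x ≈ y → trace x ≈ trace y
  trace-cong {x} {y} x≈y = begin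
    trace x                ≡⟨ trace≡powerSum x ⟩
    powerSum (upTo ns) x   ≈⟨ powerSum-cong (upTo ns) x≈y ⟩
    powerSum (upTo ns) y   ≡⟨ trace≡powerSum y ⟨
    trace y                ∎

  trace-+ : ∀ x y → trace (x + y) ≈ trace x + trace y
  trace-+ x y = begin
    trace (x + y)                              ≡⟨ trace≡powerSum (x + y) ⟩
    powerSum (upTo ns) (x + y)                 ≈⟨ powerSum-+ (upTo ns) x y ⟩
    powerSum (upTo ns) x + powerSum (upTo ns) y ≡⟨ ≡.cong₂ _+_ (trace≡powerSum x) (trace≡powerSum y) ⟨
    trace x + trace y                          ∎

  trace-0 : trace 0# ≈ 0#
  trace-0 = +-homo⇒0-homo trace trace-cong trace-+

  -- The exponents p ^ i, i < ns, are permuted cyclically since x ^ (p ^ ns) ≈ x.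
  trace-^p : ∀ x → trace (x ^ᴷ p) ≈ trace x
  trace-^p x = +-cancelˡ x _ _ (begin
    x + trace (x ^ᴷ p)                          ≡⟨ ≡.cong (x +_) (trace≡powerSum (x ^ᴷ p)) ⟩
    x + powerSum (upTo ns) (x ^ᴷ p)             ≈⟨ +-cong (*-identityʳ x) (sym (powerSum-^p (upTo ns) x)) ⟨
    x ^ᴷ 1 + powerSum (map suc (upTo ns)) x     ≡⟨ ≡.cong (λ es → x ^ᴷ 1 + powerSum es x) (map-applyUpTo id suc ns) ⟩
    powerSum (upTo (suc ns)) x                  ≡⟨ ≡.cong (λ es → powerSum es x) (upTo-∷ʳ ns) ⟨
    powerSum (upTo ns ∷ʳ ns) x                  ≈⟨ powerSum-∷ʳ (upTo ns) ns x ⟩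
    powerSum (upTo ns) x + x ^ᴷ (p ^ ns)        ≈⟨ +-cong (reflexive (≡.sym (trace≡powerSum x))) x^p^ns≈x ⟩
    trace x + x                                 ≈⟨ +-comm _ _ ⟩
    x + trace x                                 ∎)
    where
    x^p^ns≈x : x ^ᴷ (p ^ ns) ≈ x
    x^p^ns≈x = trans (^-congʳ x p^ns≡size) (fermat x)

  trace-^p^ : ∀ k x → trace (x ^ᴷ (p ^ k)) ≈ trace x
  trace-^p^ zero    x = trace-cong (*-identityʳ x)
  trace-^p^ (suc k) x = begin
    trace (x ^ᴷ (p ℕ.* p ^ k))    ≈⟨ trace-cong (^-assocʳ x p (p ^ k)) ⟨
    trace ((x ^ᴷ p) ^ᴷ (p ^ k))   ≈⟨ trace-^p^ k (x ^ᴷ p) ⟩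
    trace (x ^ᴷ p)                ≈⟨ trace-^p x ⟩
    trace x                       ∎

  trace-frobq : ∀ i x → trace (frobq i x) ≈ trace x
  trace-frobq i x = trans (trace-cong (trans (frobq≈ i x) (^-congʳ x (ℕ.^-*-assoc p s i)))) (trace-^p^ (s ℕ.* i) x)

  -- Coefficient lists

  coef : ℕ → List Carrier → Carrier
  coef _       []       = 0#
  coef zero    (c ∷ _)  = c
  coef (suc i) (_ ∷ cs) = coef i cs

  PolyEqL⇒coef≈ : ∀ xs ys → PolyEqL xs ys → ∀ i → coef i xs ≈ coef i ys
  PolyEqL⇒coef≈ []       []       _          _       = refl
  PolyEqL⇒coef≈ []       (_ ∷ ys) (e , _)    zero    = e
  PolyEqL⇒coef≈ []       (_ ∷ ys) (_ , es)   (suc i) = PolyEqL⇒coef≈ [] ys es i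
  PolyEqL⇒coef≈ (_ ∷ xs) []       (e , _)    zero    = e
  PolyEqL⇒coef≈ (_ ∷ xs) []       (_ , es)   (suc i) = PolyEqL⇒coef≈ xs [] es i
  PolyEqL⇒coef≈ (_ ∷ xs) (_ ∷ ys) (e , _)    zero    = e
  PolyEqL⇒coef≈ (_ ∷ xs) (_ ∷ ys) (_ , es)   (suc i) = PolyEqL⇒coef≈ xs ys es i

  coef≈⇒PolyEqL : ∀ xs ys → (∀ i → coef i xs ≈ coef i ys) → PolyEqL xs ys
  coef≈⇒PolyEqL []       []       _ = tt
  coef≈⇒PolyEqL []       (_ ∷ ys) e = e 0 , coef≈⇒PolyEqL [] ys (e ∘ suc)
  coef≈⇒PolyEqL (_ ∷ xs) []       e = e 0 , coef≈⇒PolyEqL xs [] (e ∘ suc)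
  coef≈⇒PolyEqL (_ ∷ xs) (_ ∷ ys) e = e 0 , coef≈⇒PolyEqL xs ys (e ∘ suc)

  polySetoid : Setoid 0ℓ 0ℓ
  polySetoid = record
    { Carrier       = List Carrier
    ; _≈_           = PolyEqL
    ; isEquivalence = record
      { refl  = λ {xs} → coef≈⇒PolyEqL xs xs (λ _ → refl)
      ; sym   = λ {xs} {ys} e → coef≈⇒PolyEqL ys xs (sym ∘ PolyEqL⇒coef≈ xs ys e)
      ; trans = λ {xs} {ys} {zs} e f → coef≈⇒PolyEqL xs zs λ i →
                  trans (PolyEqL⇒coef≈ xs ys e i) (PolyEqL⇒coef≈ ys zs f i)
      }
    }

  module ≈ₚ = Setoid polySetoid

  coef-addL : ∀ i xs ys → coef i (addL xs ys) ≈ coef i xs + coef i ys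
  coef-addL i       []       ys       = sym (+-identityˡ _)
  coef-addL zero    (x ∷ xs) []       = sym (+-identityʳ _)
  coef-addL (suc i) (x ∷ xs) []       = sym (+-identityʳ _)
  coef-addL zero    (x ∷ xs) (y ∷ ys) = refl
  coef-addL (suc i) (x ∷ xs) (y ∷ ys) = coef-addL i xs ys

  coef-scaleL : ∀ i a xs → coef i (scaleL a xs) ≈ a * coef i xs
  coef-scaleL i       a []       = sym (zeroʳ a)
  coef-scaleL zero    a (x ∷ xs) = refl
  coef-scaleL (suc i) a (x ∷ xs) = coef-scaleL i a xs

  coef-mulL : ∀ i x xs ys → coef i (mulL (x ∷ xs) ys) ≈ x * coef i ys + coef i (0# ∷ mulL xs ys)
  coef-mulL i x xs ys = trans (coef-addL i (scaleL x ys) _) (+-congʳ (coef-scaleL i x ys))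

  mulL-congʳ : ∀ xs {ys ys′} → PolyEqL ys ys′ → PolyEqL (mulL xs ys) (mulL xs ys′)
  mulL-congʳ []       _ = tt
  mulL-congʳ (x ∷ xs) {ys} {ys′} e = coef≈⇒PolyEqL _ _ λ i → begin
    coef i (mulL (x ∷ xs) ys)                   ≈⟨ coef-mulL i x xs ys ⟩
    x * coef i ys + coef i (0# ∷ mulL xs ys)    ≈⟨ +-cong (*-congˡ (PolyEqL⇒coef≈ ys ys′ e i)) (shifted i) ⟩
    x * coef i ys′ + coef i (0# ∷ mulL xs ys′)  ≈⟨ coef-mulL i x xs ys′ ⟨
    coef i (mulL (x ∷ xs) ys′)                  ∎
    where
    shifted : ∀ i → coef i (0# ∷ mulL xs ys) ≈ coef i (0# ∷ mulL xs ys′)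
    shifted zero    = refl
    shifted (suc i) = PolyEqL⇒coef≈ _ _ (mulL-congʳ xs e) i

  mulL-[] : ∀ xs → PolyEqL (mulL xs []) []
  mulL-[] []       = tt
  mulL-[] (x ∷ xs) = refl , mulL-[] xs

  mulL-[d] : ∀ xs d → PolyEqL (mulL xs (d ∷ [])) (scaleL d xs)
  mulL-[d] []       d = tt
  mulL-[d] (x ∷ xs) d = trans (+-identityʳ _) (*-comm x d) , mulL-[d] xs d

  scaleL-by-1 : ∀ {a} xs → a ≈ 1# → PolyEqL (scaleL a xs) xs
  scaleL-by-1 {a} xs a≈1 = coef≈⇒PolyEqL _ _ λ i →
    trans (coef-scaleL i a xs) (trans (*-congʳ a≈1) (*-identityˡ _))

  length-addL : ∀ xs ys → length xs ≤ length ys → length (addL xs ys) ≡ length ys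
  length-addL []       ys       _         = ≡.refl
  length-addL (x ∷ xs) (y ∷ ys) (s≤s le)  = ≡.cong suc (length-addL xs ys le)

  LeadingCoeff-addL : ∀ xs ys {b} → length xs < length ys → LeadingCoeff ys b → LeadingCoeff (addL xs ys) b
  LeadingCoeff-addL []       ys           _              lead = lead
  LeadingCoeff-addL (x ∷ xs) (y ∷ y′ ∷ ys) (s≤s lt) lead =
    LeadingCoeff-∷ (x + y) (addL xs (y′ ∷ ys)) (LeadingCoeff-addL xs (y′ ∷ ys) lt lead)

  eval-addL : ∀ xs ys x → eval (addL xs ys) x ≈ eval xs x + eval ys x
  eval-addL []       ys       x = sym (+-identityˡ _)
  eval-addL (a ∷ xs) []       x = sym (+-identityʳ _)
  eval-addL (a ∷ xs) (b ∷ ys) x = begin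
    (a + b) + x * eval (addL xs ys) x       ≈⟨ +-congˡ (*-congˡ (eval-addL xs ys x)) ⟩
    (a + b) + x * (eval xs x + eval ys x)   ≈⟨ +-congˡ (distribˡ x _ _) ⟩
    (a + b) + (x * eval xs x + x * eval ys x) ≈⟨ +-interchange _ _ _ _ ⟩
    (a + x * eval xs x) + (b + x * eval ys x) ∎

  mulL-∷-leading : ∀ x x′ xs ys {c} → LeadingCoeff (mulL (x′ ∷ xs) ys) c →
                   suc (length (mulL (x′ ∷ xs) ys)) ≡ length (x′ ∷ xs) ℕ.+ length ys →
                   LeadingCoeff (mulL (x ∷ x′ ∷ xs) ys) c ×
                   suc (length (mulL (x ∷ x′ ∷ xs) ys)) ≡ length (x ∷ x′ ∷ xs) ℕ.+ length ys
  mulL-∷-leading x x′ xs ys lead len =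
    LeadingCoeff-addL (scaleL x ys) (0# ∷ R) shorter (LeadingCoeff-∷ 0# R lead) ,
    ≡.cong suc (≡.trans (length-addL (scaleL x ys) (0# ∷ R) (ℕ.<⇒≤ shorter)) len)
    where
    R = mulL (x′ ∷ xs) ys
    shorter : length (scaleL x ys) < length (0# ∷ R)
    shorter = s≤s (≡.subst₂ _≤_ (≡.sym (length-map (x *_) ys)) (≡.sym (ℕ.suc-injective len))
                    (ℕ.m≤n+m (length ys) (length xs)))

  mulL-leading : ∀ xs ys {a b} → LeadingCoeff xs a → LeadingCoeff ys b →
                 LeadingCoeff (mulL xs ys) (a * b) × suc (length (mulL xs ys)) ≡ length xs ℕ.+ length ys
  mulL-leading (x ∷ []) (y ∷ [])       x≈a y≈b  = trans (+-identityʳ _) (*-cong x≈a y≈b) , ≡.refl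
  mulL-leading (x ∷ []) (y ∷ y′ ∷ ys)  x≈a lead =
    LeadingCoeff-resp (scaleL x (y′ ∷ ys)) (*-congʳ x≈a) (LeadingCoeff-map-* x (y′ ∷ ys) lead) ,
    ≡.cong (suc ∘ suc ∘ suc) (length-map (x *_) ys)
  mulL-leading (x ∷ x′ ∷ xs) ys lead-xs lead-ys =
    let lead , len = mulL-leading (x′ ∷ xs) ys lead-xs lead-ys in mulL-∷-leading x x′ xs ys lead len

  normalise : ∀ ks → PolyEqL ks [] ⊎ ∃ λ ks′ → PolyEqL ks ks′ × ∃ λ b → LeadingCoeff ks′ b × b ≉ 0#
  normalise [] = inj₁ tt
  normalise (k ∷ ks) with normalise ks
  ... | inj₂ (ks′ , ks≈ks′ , b , lead , b≉0) = inj₂ (k ∷ ks′ , (refl , ks≈ks′) , b , LeadingCoeff-∷ k ks′ lead , b≉0)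
  ... | inj₁ ks≈[] with k ≟ 0#
  ...   | yes k≈0 = inj₁ (k≈0 , ks≈[])
  ...   | no k≉0  = inj₂ (k ∷ [] , (refl , ks≈[]) , k , refl , k≉0)

  PolyEqL-[]⇒leading≈0 : ∀ xs {b} → PolyEqL xs [] → LeadingCoeff xs b → b ≈ 0#
  PolyEqL-[]⇒leading≈0 (x ∷ [])      (x≈0 , _) x≈b  = trans (sym x≈b) x≈0
  PolyEqL-[]⇒leading≈0 (_ ∷ x ∷ xs)  (_ , e)   lead = PolyEqL-[]⇒leading≈0 (x ∷ xs) e lead

  PolyEqL-leading : ∀ xs ys {a b} → PolyEqL xs ys → LeadingCoeff xs a → LeadingCoeff ys b →
                    a ≉ 0# → b ≉ 0# → length xs ≡ length ys × a ≈ b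
  PolyEqL-leading (x ∷ [])     (y ∷ [])     (x≈y , _) x≈a y≈b _ _ = ≡.refl , trans (sym x≈a) (trans x≈y y≈b)
  PolyEqL-leading (x ∷ [])     (y ∷ y′ ∷ ys) (_ , e) _  lb _   b≉0 =
    ⊥-elim (b≉0 (PolyEqL-[]⇒leading≈0 (y′ ∷ ys) (≈ₚ.sym {[]} {y′ ∷ ys} e) lb))
  PolyEqL-leading (x ∷ x′ ∷ xs) (y ∷ [])     (_ , e) la _  a≉0 _   =
    ⊥-elim (a≉0 (PolyEqL-[]⇒leading≈0 (x′ ∷ xs) e la))
  PolyEqL-leading (x ∷ x′ ∷ xs) (y ∷ y′ ∷ ys) (_ , e) la lb a≉0 b≉0 =
    let len , a≈b = PolyEqL-leading (x′ ∷ xs) (y′ ∷ ys) e la lb a≉0 b≉0 in ≡.cong suc len , a≈b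

  module _ (m f : List Carrier) {b} (m-monic : LeadingCoeff m 1#) (lead-f : LeadingCoeff f b) (b≉0 : b ≉ 0#) where

    monicDivisor-cofactor : ∀ ks → PolyEqL f (mulL m ks) →
      ∃ λ ks′ → PolyEqL f (mulL m ks′) × (∃ λ c → LeadingCoeff ks′ c × c ≉ 0#) ×
                suc (length f) ≡ length m ℕ.+ length ks′
    monicDivisor-cofactor ks f≈mks with normalise ks
    ... | inj₁ ks≈[] = ⊥-elim (b≉0 (PolyEqL-[]⇒leading≈0 f
          (≈ₚ.trans f≈mks (≈ₚ.trans (mulL-congʳ m ks≈[]) (mulL-[] m))) lead-f))
    ... | inj₂ (ks′ , ks≈ks′ , c , lead-ks′ , c≉0) =
      ks′ , f≈mks′ , (c , lead-ks′ , c≉0) , ≡.trans (≡.cong suc f≡mks′) (proj₂ lead-mks′)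
      where
      f≈mks′ = ≈ₚ.trans f≈mks (mulL-congʳ m ks≈ks′)
      lead-mks′ = mulL-leading m ks′ m-monic lead-ks′
      f≡mks′ : length f ≡ length (mulL m ks′)
      f≡mks′ = proj₁ (PolyEqL-leading f (mulL m ks′) f≈mks′ lead-f (proj₁ lead-mks′) b≉0
                 (λ 1c≈0 → c≉0 (trans (sym (*-identityˡ c)) 1c≈0)))

    monicDivisor-length≤ : ∀ ks → PolyEqL f (mulL m ks) → length m ≤ length f
    monicDivisor-length≤ ks f≈mks with monicDivisor-cofactor ks f≈mks
    ... | [] , _ , (_ , () , _) , _
    ... | k ∷ ks′ , _ , _ , len = ≡.subst (length m ≤_)
          (ℕ.suc-injective (≡.sym (≡.trans len (ℕ.+-suc (length m) (length ks′)))))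
          (ℕ.m≤m+n (length m) (length ks′))

  monicDivisor-equal : ∀ m f ks → LeadingCoeff m 1# → LeadingCoeff f 1# → length f ≤ length m →
                       PolyEqL f (mulL m ks) → PolyEqL f m
  monicDivisor-equal m f ks m-monic f-monic f≤m f≈mks
    with monicDivisor-cofactor m f m-monic f-monic 1≉0 ks f≈mks
  ... | [] , _ , (_ , () , _) , _
  ... | k ∷ k′ ∷ ks′ , _ , _ , len = ⊥-elim (ℕ.<⇒≱ m<f f≤m)
    where
    m<f : length m < length f
    m<f = ≡.subst (length m <_)
      (ℕ.suc-injective (≡.sym (≡.trans len (ℕ.+-suc (length m) (suc (length ks′))))))
      (ℕ.m<m+n (length m) (s≤s z≤n))
  ... | d ∷ [] , f≈md , (c , d≈c , c≉0) , _ = ≈ₚ.trans f≈dm (scaleL-by-1 m d≈1)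
    where
    f≈dm : PolyEqL f (scaleL d m)
    f≈dm = ≈ₚ.trans f≈md (mulL-[d] m d)
    d≉0 : d ≉ 0#
    d≉0 d≈0 = c≉0 (trans (sym d≈c) d≈0)
    d≈1 : d ≈ 1#
    d≈1 = trans (sym (*-identityʳ d)) (sym (proj₂ (PolyEqL-leading f (scaleL d m) f≈dm f-monic
            (LeadingCoeff-map-* d m m-monic) 1≉0 (λ d1≈0 → d≉0 (trans (sym (*-identityʳ d)) d1≈0)))))

  monomial : ℕ → List Carrier
  monomial zero    = 1# ∷ []
  monomial (suc e) = 0# ∷ monomial e

  length-monomial : ∀ e → length (monomial e) ≡ suc e
  length-monomial zero    = ≡.refl
  length-monomial (suc e) = ≡.cong suc (length-monomial e)

  LeadingCoeff-monomial : ∀ e → LeadingCoeff (monomial e) 1#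
  LeadingCoeff-monomial zero    = refl
  LeadingCoeff-monomial (suc e) = LeadingCoeff-∷ 0# (monomial e) (LeadingCoeff-monomial e)

  eval-monomial : ∀ e x → eval (monomial e) x ≈ x ^ᴷ e
  eval-monomial zero    x = eval-[c] 1# x
  eval-monomial (suc e) x = trans (+-identityˡ _) (*-congˡ (eval-monomial e x))

  tracePoly : ℕ → List Carrier
  tracePoly zero    = []
  tracePoly (suc m) = addL (tracePoly m) (monomial (p ^ m))

  eval-tracePoly : ∀ m x → eval (tracePoly m) x ≈ powerSum (upTo m) x
  eval-tracePoly zero    x = refl
  eval-tracePoly (suc m) x = begin
    eval (addL (tracePoly m) (monomial (p ^ m))) x        ≈⟨ eval-addL (tracePoly m) _ x ⟩
    eval (tracePoly m) x + eval (monomial (p ^ m)) x      ≈⟨ +-cong (eval-tracePoly m x) (eval-monomial (p ^ m) x) ⟩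
    powerSum (upTo m) x + x ^ᴷ (p ^ m)                    ≈⟨ powerSum-∷ʳ (upTo m) m x ⟨
    powerSum (upTo m ∷ʳ m) x                              ≡⟨ ≡.cong (λ es → powerSum es x) (upTo-∷ʳ m) ⟩
    powerSum (upTo (suc m)) x                             ∎

  length-tracePoly≤ : ∀ m → length (tracePoly m) ≤ p ^ m

  tracePoly-shorter : ∀ m → length (tracePoly m) < length (monomial (p ^ m))
  tracePoly-shorter m =
    ≡.subst (length (tracePoly m) <_) (≡.sym (length-monomial (p ^ m))) (s≤s (length-tracePoly≤ m))

  length-tracePoly : ∀ m → length (tracePoly (suc m)) ≡ suc (p ^ m)
  length-tracePoly m =
    ≡.trans (length-addL (tracePoly m) _ (ℕ.<⇒≤ (tracePoly-shorter m))) (length-monomial (p ^ m))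

  length-tracePoly≤ zero    = z≤n
  length-tracePoly≤ (suc m) = ≡.subst (_≤ p ^ suc m) (≡.sym (length-tracePoly m))
    (ℕ.^-monoʳ-< p 1<p (ℕ.n<1+n m))

  LeadingCoeff-tracePoly : ∀ m → LeadingCoeff (tracePoly (suc m)) 1#
  LeadingCoeff-tracePoly m =
    LeadingCoeff-addL (tracePoly m) (monomial (p ^ m)) (tracePoly-shorter m) (LeadingCoeff-monomial (p ^ m))

  -- Every one of the (p ^ s) ^ n elements is then a root of tracePoly (suc m), of degree p ^ m.
  size≤ : ∀ m → (∀ y → powerSum (upTo (suc m)) y ≈ 0#) → (p ^ s) ^ n ≤ p ^ m
  size≤ m vanishes = ℕ.≤-pred (≡.subst ((p ^ s) ^ n <_) (length-tracePoly m)
    (distinctRoots<length (tracePoly (suc m)) (LeadingCoeff-tracePoly m) 1≉0 Enum.to to-injective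
      (λ i → trans (eval-tracePoly (suc m) _) (vanishes _))))
    where
    to-injective : ∀ {i j} → Enum.to i ≈ Enum.to j → i ≡ j
    to-injective {i} {j} eq =
      ≡.trans (≡.sym (Enum.strictlyInverseʳ i)) (≡.trans (Enum.from-cong eq) (Enum.strictlyInverseʳ j))

  trace≉0 : ¬ (∀ y → trace y ≈ 0#)
  trace≉0 vanishes = ℕ.<⇒≱ size> (size≤ (ℕ.pred ns) vanishes′)
    where
    instance _ = ℕ.>-nonZero (ℕ.*-mono-≤ n≥1 s≥1)
    vanishes′ : ∀ y → powerSum (upTo (suc (ℕ.pred ns))) y ≈ 0#
    vanishes′ = ≡.subst (λ k → ∀ y → powerSum (upTo k) y ≈ 0#) (≡.sym (ℕ.suc-pred ns))
      (λ y → trans (reflexive (≡.sym (trace≡powerSum y))) (vanishes y))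
    size> : p ^ ℕ.pred ns < (p ^ s) ^ n
    size> = ≡.subst (p ^ ℕ.pred ns <_) (≡.trans (≡.cong (p ^_) (ℕ.suc-pred ns)) p^ns≡size)
      (ℕ.^-monoʳ-< p 1<p (ℕ.n<1+n (ℕ.pred ns)))

  trace-nondegenerate : ∀ z → (∀ y → trace (y * z) ≈ 0#) → z ≈ 0#
  trace-nondegenerate z vanishes with z ≟ 0#
  ... | yes z≈0 = z≈0
  ... | no z≉0  = ⊥-elim (trace≉0 λ y → trans (trace-cong (sym (begin
    (y * z ⁻¹) * z   ≈⟨ *-assoc y _ z ⟩
    y * (z ⁻¹ * z)   ≈⟨ *-congˡ (x⁻¹*x≈1 z≉0) ⟩
    y * 1#           ≈⟨ *-identityʳ y ⟩
    y                ∎))) (vanishes (y * z ⁻¹)))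

  -- Trace duality

  actL-++ : ∀ i xs ys α → actL i (xs ++ ys) α ≈ actL i xs α + actL (i ℕ.+ length xs) ys α
  actL-++ i []       ys α = trans (reflexive (≡.cong (λ j → actL j ys α) (≡.sym (ℕ.+-identityʳ i))))
                                  (sym (+-identityˡ _))
  actL-++ i (x ∷ xs) ys α = begin
    a + actL (suc i) (xs ++ ys) α                                 ≈⟨ +-congˡ (actL-++ (suc i) xs ys α) ⟩
    a + (actL (suc i) xs α + actL (suc i ℕ.+ length xs) ys α)     ≈⟨ +-assoc _ _ _ ⟨
    (a + actL (suc i) xs α) + actL (suc i ℕ.+ length xs) ys α     ≡⟨ ≡.cong (λ j → a′ + actL j ys α) (≡.sym (ℕ.+-suc i (length xs))) ⟩
    (a + actL (suc i) xs α) + actL (i ℕ.+ suc (length xs)) ys α   ∎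
    where
    a  = x * frobq i α
    a′ = a + actL (suc i) xs α

  actL-reverse-∷ : ∀ b bs α →
                   actL 1 (reverse (b ∷ bs)) α ≈ actL 1 (reverse bs) α + b * frobq (suc (length bs)) α
  actL-reverse-∷ b bs α = begin
    actL 1 (reverse (b ∷ bs)) α                            ≡⟨ ≡.cong (λ cs → actL 1 cs α) (unfold-reverse b bs) ⟩
    actL 1 (reverse bs ++ b ∷ []) α                        ≈⟨ actL-++ 1 (reverse bs) (b ∷ []) α ⟩
    A + actL (suc (length (reverse bs))) (b ∷ []) α        ≡⟨ ≡.cong (λ l → A + actL (suc l) (b ∷ []) α) (length-reverse bs) ⟩
    A + (b * frobq (suc (length bs)) α + 0#)               ≈⟨ +-congˡ (+-identityʳ _) ⟩
    A + b * frobq (suc (length bs)) α                      ∎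
    where A = actL 1 (reverse bs) α

  actL-frobq : ∀ i cs α → All InFq cs → actL (suc i) cs α ≈ frobq 1 (actL i cs α)
  actL-frobq i []       α []            = sym (frobq-0 1)
  actL-frobq i (c ∷ cs) α (c∈Fq ∷ cs∈Fq) = sym (begin
    frobq 1 (c * frobq i α + actL (suc i) cs α)                   ≈⟨ frobq-+ 1 _ _ ⟩
    frobq 1 (c * frobq i α) + frobq 1 (actL (suc i) cs α)         ≈⟨ +-cong (frobq-* 1 c _) (sym (actL-frobq (suc i) cs α cs∈Fq)) ⟩
    frobq 1 c * frobq 1 (frobq i α) + actL (suc (suc i)) cs α     ≈⟨ +-congʳ (*-cong (InFq⇒frobq1≈ c∈Fq) (frobq-∘ 1 i α)) ⟩
    c * frobq (suc i) α + actL (suc (suc i)) cs α                 ∎)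

  trace-*-+ : ∀ a x y → trace (a * (x + y)) ≈ trace (a * x) + trace (a * y)
  trace-*-+ a x y = trans (trace-cong (distribˡ a x y)) (trace-+ _ _)

  trace-term-duality : ∀ α β i l {b} → InFq b →
    trace (α * (b * frobq i β)) ≈ trace (frobq (i ℕ.+ l) β * (b * frobq l α))
  trace-term-duality α β i l {b} b∈Fq = begin
    trace (α * (b * frobq i β))                          ≈⟨ trace-frobq l _ ⟨
    trace (frobq l (α * (b * frobq i β)))                ≈⟨ trace-cong (trans (frobq-* l α _) (*-congˡ (frobq-* l b _))) ⟩
    trace (frobq l α * (frobq l b * frobq l (frobq i β))) ≈⟨ trace-cong (*-congˡ (*-cong (frobq-InFq l b∈Fq) (frobq-∘ l i β))) ⟩
    trace (frobq l α * (b * frobq (l ℕ.+ i) β))          ≡⟨ ≡.cong (λ j → trace (frobq l α * (b * frobq j β))) (ℕ.+-comm l i) ⟩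
    trace (frobq l α * (b * frobq (i ℕ.+ l) β))          ≈⟨ trace-cong (x∙yz≈z∙yx _ _ _) ⟩
    trace (frobq (i ℕ.+ l) β * (b * frobq l α))          ∎

  trace-duality : ∀ α β i bs → All InFq bs →
    trace (α * actL i bs β) ≈ trace (frobq (i ℕ.+ length bs) β * actL 1 (reverse bs) α)
  trace-duality α β i []       [] =
    trans (trace-cong (zeroʳ α)) (trans trace-0 (sym (trans (trace-cong (zeroʳ _)) trace-0)))
  trace-duality α β i (b ∷ bs) (b∈Fq ∷ bs∈Fq) = begin
    trace (α * (b * frobq i β + actL (suc i) bs β))               ≈⟨ trace-*-+ α _ _ ⟩
    trace (α * (b * frobq i β)) + trace (α * actL (suc i) bs β)   ≈⟨ +-cong (trace-term-duality α β i l b∈Fq) IH ⟩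
    trace (B * (b * frobq l α)) + trace (B * A)                   ≈⟨ +-comm _ _ ⟩
    trace (B * A) + trace (B * (b * frobq l α))                   ≈⟨ trace-*-+ B _ _ ⟨
    trace (B * (A + b * frobq l α))                               ≈⟨ trace-cong (*-congˡ (actL-reverse-∷ b bs α)) ⟨
    trace (B * actL 1 (reverse (b ∷ bs)) α)                       ∎
    where
    l = suc (length bs)
    A = actL 1 (reverse bs) α
    B = frobq (i ℕ.+ l) β
    IH : trace (α * actL (suc i) bs β) ≈ trace (B * A)
    IH = trans (trace-duality α β (suc i) bs bs∈Fq)
               (reflexive (≡.cong (λ j → trace (frobq j β * A)) (≡.sym (ℕ.+-suc i (length bs)))))

  InFq-reverse : ∀ bs → All InFq bs → All InFq (reverse bs)
  InFq-reverse bs = All-resp-↭ (↭-sym (↭-reverse bs))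

  reversePoly : Poly → Poly
  reversePoly (bs , bs∈Fq) = reverse bs , InFq-reverse bs bs∈Fq

  trivial⇔reverse-annihilates : ∀ α f → IsTrivial (f ∘χ χ α) ⇔ (reversePoly f ∘ₚ α ≈ 0#)
  trivial⇔reverse-annihilates α f@(bs , bs∈Fq) = mk⇔ trivial⇒ ⇐annihilates
    where
    A = actL 1 (reverse bs) α
    A≈frobq : A ≈ frobq 1 (reversePoly f ∘ₚ α)
    A≈frobq = actL-frobq 0 (reverse bs) α (proj₂ (reversePoly f))
    trivial⇒ : IsTrivial (f ∘χ χ α) → reversePoly f ∘ₚ α ≈ 0#
    trivial⇒ trivial = frobq-≈0 1 (trans (sym A≈frobq) (trace-nondegenerate A λ y →
      let β , β↦y = frobq-surjective (length bs) y in begin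
      trace (y * A)                       ≈⟨ trace-cong (*-congʳ β↦y) ⟨
      trace (frobq (length bs) β * A)     ≈⟨ trace-duality α β 0 bs bs∈Fq ⟨
      trace (α * (f ∘ₚ β))                ≈⟨ trivial β ⟩
      0#                                  ∎))
    ⇐annihilates : reversePoly f ∘ₚ α ≈ 0# → IsTrivial (f ∘χ χ α)
    ⇐annihilates annihilates β = begin
      trace (α * (f ∘ₚ β))                ≈⟨ trace-duality α β 0 bs bs∈Fq ⟩
      trace (frobq (length bs) β * A)     ≈⟨ trace-cong (*-congˡ (trans A≈frobq (trans (frobq-cong 1 annihilates) (frobq-0 1)))) ⟩
      trace (frobq (length bs) β * 0#)    ≈⟨ trace-cong (zeroʳ _) ⟩
      trace 0#                            ≈⟨ trace-0 ⟩
      0#                                  ∎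

  -- Orders

  actL-scaleL : ∀ i a xs α → actL i (scaleL a xs) α ≈ a * actL i xs α
  actL-scaleL i a []       α = sym (zeroʳ a)
  actL-scaleL i a (x ∷ xs) α = begin
    (a * x) * frobq i α + actL (suc i) (scaleL a xs) α   ≈⟨ +-cong (*-assoc a x _) (actL-scaleL (suc i) a xs α) ⟩
    a * (x * frobq i α) + a * actL (suc i) xs α          ≈⟨ distribˡ a _ _ ⟨
    a * (x * frobq i α + actL (suc i) xs α)              ∎

  actL-monomial : ∀ i e β → actL i (monomial e) β ≈ frobq (i ℕ.+ e) β
  actL-monomial i zero    β = trans (+-identityʳ _) (trans (*-identityˡ _)
    (reflexive (≡.cong (λ j → frobq j β) (≡.sym (ℕ.+-identityʳ i)))))
  actL-monomial i (suc e) β = trans (+-congʳ (zeroˡ _)) (trans (+-identityˡ _) (trans (actL-monomial (suc i) e β)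
    (reflexive (≡.cong (λ j → frobq j β) (≡.sym (ℕ.+-suc i e))))))

  pow-1# : ∀ k → pow 1# k ≈ 1#
  pow-1# zero    = refl
  pow-1# (suc k) = trans (*-identityˡ _) (pow-1# k)

  frobq1≈⇒InFq : ∀ {x} → frobq 1 x ≈ x → InFq x
  frobq1≈⇒InFq {x} fixed = trans (reflexive (≡.cong (pow x) (≡.sym (ℕ.*-identityʳ q)))) fixed

  InFq-* : ∀ {a b} → InFq a → InFq b → InFq (a * b)
  InFq-* a∈Fq b∈Fq = frobq1≈⇒InFq (trans (frobq-* 1 _ _) (*-cong (InFq⇒frobq1≈ a∈Fq) (InFq⇒frobq1≈ b∈Fq)))

  InFq-⁻¹ : ∀ {c} → c ≉ 0# → InFq c → InFq (c ⁻¹)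
  InFq-⁻¹ {c} c≉0 c∈Fq = frobq1≈⇒InFq (*-cancelʳ c≉0 (begin
    frobq 1 (c ⁻¹) * c             ≈⟨ *-congˡ (InFq⇒frobq1≈ c∈Fq) ⟨
    frobq 1 (c ⁻¹) * frobq 1 c     ≈⟨ frobq-* 1 _ _ ⟨
    frobq 1 (c ⁻¹ * c)             ≈⟨ frobq-cong 1 (x⁻¹*x≈1 c≉0) ⟩
    frobq 1 1#                     ≈⟨ pow-1# (q ^ 1) ⟩
    1#                             ≈⟨ x⁻¹*x≈1 c≉0 ⟨
    c ⁻¹ * c                       ∎))

  InFq-neg1 : InFq (- 1#)
  InFq-neg1 = frobq1≈⇒InFq (trans (+-homo⇒-‿homo (frobq 1) (frobq-cong 1) (frobq-+ 1) 1#) (-‿cong (pow-1# (q ^ 1))))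

  InFq-monomial : ∀ e → All InFq (monomial e)
  InFq-monomial zero    = pow-1# q ∷ []
  InFq-monomial (suc e) = frobq1≈⇒InFq (frobq-0 1) ∷ InFq-monomial e

  -- (- 1#) ∷ monomial e is x ^ (e + 1) - 1; here e + 1 = n as n ≥ 1.
  xⁿ-1 : Poly
  xⁿ-1 = (- 1#) ∷ monomial (ℕ.pred n) , InFq-neg1 ∷ InFq-monomial (ℕ.pred n)

  xⁿ-1-annihilates : ∀ β → xⁿ-1 ∘ₚ β ≈ 0#
  xⁿ-1-annihilates β = begin
    - 1# * frobq 0 β + actL 1 (monomial (ℕ.pred n)) β ≈⟨ +-cong -1*β≈-β (actL-monomial 1 (ℕ.pred n) β) ⟩
    - β + frobq (suc (ℕ.pred n)) β                  ≡⟨ ≡.cong (λ e → - β + frobq e β) (ℕ.suc-pred n) ⟩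
    - β + frobq n β                                 ≈⟨ +-congˡ (frobq-n β) ⟩
    - β + β                                         ≈⟨ -‿inverseˡ β ⟩
    0#                                              ∎
    where
    instance _ = ℕ.>-nonZero n≥1
    -1*β≈-β : - 1# * frobq 0 β ≈ - β
    -1*β≈-β = trans (-1*x≈-x _) (-‿cong (*-identityʳ β))

  divides-xⁿ-1⇒const≉0 : ∀ f → f ∣ₚ xⁿ-1 → const f ≉ 0#
  divides-xⁿ-1⇒const≉0 ([] , _)      (_ , -1≈0 , _) _ = 1≉0 (-x≈0⇒x≈0 -1≈0)
  divides-xⁿ-1⇒const≉0 (c ∷ cs , _)  (ks , xⁿ-1≈gks) c≈0 = 1≉0 (-x≈0⇒x≈0 (begin
    - 1#                                  ≈⟨ PolyEqL⇒coef≈ _ _ xⁿ-1≈gks 0 ⟩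
    coef 0 (mulL (c ∷ cs) (coeffs ks))     ≈⟨ coef-mulL 0 c cs (coeffs ks) ⟩
    c * coef 0 (coeffs ks) + 0#           ≈⟨ +-identityʳ _ ⟩
    c * coef 0 (coeffs ks)                ≈⟨ *-congʳ c≈0 ⟩
    0# * coef 0 (coeffs ks)               ≈⟨ zeroˡ _ ⟩
    0#                                    ∎))

  order-const≉0 : ∀ α g → IsFqOrder α g → const g ≉ 0#
  order-const≉0 α g (_ , _ , minimal) = divides-xⁿ-1⇒const≉0 g (minimal xⁿ-1 (xⁿ-1-annihilates α))

  charOrder-const≉0 : ∀ α h → IsCharFqOrder (χ α) h → const h ≉ 0#
  charOrder-const≉0 α h (_ , _ , minimal) = divides-xⁿ-1⇒const≉0 h (minimal xⁿ-1 λ β →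
    trans (trace-cong (trans (*-congˡ (xⁿ-1-annihilates β)) (zeroʳ α))) trace-0)

  Monic⇒LeadingCoeff : ∀ f → Monic f → LeadingCoeff (coeffs f) 1#
  Monic⇒LeadingCoeff f (c , last≡c , c≈1) =
    LeadingCoeff-resp (coeffs f) c≈1 (last≡just⇒LeadingCoeff (coeffs f) last≡c)

  const-InFq : ∀ f → InFq (const f)
  const-InFq ([] , [])             = frobq1≈⇒InFq (frobq-0 1)
  const-InFq (_ ∷ _ , c∈Fq ∷ _)    = c∈Fq

  reciprocal : ∀ f → const f ≉ 0# → Poly
  reciprocal f@(bs , bs∈Fq) c≉0 =
    reciprocalL f , map⁺ (All.map (InFq-* (InFq-⁻¹ c≉0 (const-InFq f))) (InFq-reverse bs bs∈Fq))

  LeadingCoeff-reciprocalL : ∀ f → const f ≉ 0# → LeadingCoeff (reciprocalL f) 1#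
  LeadingCoeff-reciprocalL ([] , _)     0≉0 = ⊥-elim (0≉0 refl)
  LeadingCoeff-reciprocalL f@(c ∷ cs , _) c≉0 = LeadingCoeff-resp (reciprocalL f) (x⁻¹*x≈1 c≉0)
    (LeadingCoeff-map-* (c ⁻¹) (reverse (c ∷ cs)) (LeadingCoeff-reverse c cs))

  length-reciprocalL : ∀ f → length (reciprocalL f) ≡ length (coeffs f)
  length-reciprocalL f = ≡.trans (length-map (const f ⁻¹ *_) (reverse (coeffs f))) (length-reverse (coeffs f))

  reverse-reciprocalL : ∀ f → reverse (reciprocalL f) ≡ scaleL (const f ⁻¹) (coeffs f)
  reverse-reciprocalL f = ≡.trans (≡.sym (reverse-map (const f ⁻¹ *_) (reverse (coeffs f))))
                                  (≡.cong (scaleL (const f ⁻¹)) (reverse-involutive (coeffs f)))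

  mutual-reciprocal-divisors : ∀ g h (c≉0 : const g ≉ 0#) (d≉0 : const h ≉ 0#) → Monic g → Monic h →
    h ∣ₚ reciprocal g c≉0 → g ∣ₚ reciprocal h d≉0 →
    PolyEqL (reciprocalL g) (coeffs h) × PolyEqL (reciprocalL h) (coeffs g)
  mutual-reciprocal-divisors g h c≉0 d≉0 g-monic h-monic (k , g*≈hk) (l , h*≈gl) =
    monicDivisor-equal H (reciprocalL g) (coeffs k) H-monic (LeadingCoeff-reciprocalL g c≉0) g*≤H g*≈hk ,
    monicDivisor-equal G (reciprocalL h) (coeffs l) G-monic (LeadingCoeff-reciprocalL h d≉0) h*≤G h*≈gl
    where
    G = coeffs g
    H = coeffs h
    G-monic = Monic⇒LeadingCoeff g g-monic
    H-monic = Monic⇒LeadingCoeff h h-monic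
    H≤g* = monicDivisor-length≤ H (reciprocalL g) H-monic (LeadingCoeff-reciprocalL g c≉0) 1≉0 _ g*≈hk
    G≤h* = monicDivisor-length≤ G (reciprocalL h) G-monic (LeadingCoeff-reciprocalL h d≉0) 1≉0 _ h*≈gl
    g*≤H : length (reciprocalL g) ≤ length H
    g*≤H = ≡.subst₂ _≤_ (≡.sym (length-reciprocalL g)) (length-reciprocalL h) G≤h*
    h*≤G : length (reciprocalL h) ≤ length G
    h*≤G = ≡.subst₂ _≤_ (≡.sym (length-reciprocalL h)) (length-reciprocalL g) H≤g*

  charOrder∣reciprocal : ∀ α g h (g-order : IsFqOrder α g) → IsCharFqOrder (χ α) h →
                         h ∣ₚ reciprocal g (order-const≉0 α g g-order)
  charOrder∣reciprocal α g h g-order@(_ , g-annihilates , _) (_ , _ , h-minimal) =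
    h-minimal g* (Equivalence.from (trivial⇔reverse-annihilates α g*) (begin
      actL 0 (reverse (reciprocalL g)) α      ≡⟨ ≡.cong (λ bs → actL 0 bs α) (reverse-reciprocalL g) ⟩
      actL 0 (scaleL (const g ⁻¹) (coeffs g)) α ≈⟨ actL-scaleL 0 _ (coeffs g) α ⟩
      const g ⁻¹ * (g ∘ₚ α)                   ≈⟨ *-congˡ g-annihilates ⟩
      const g ⁻¹ * 0#                         ≈⟨ zeroʳ _ ⟩
      0#                                      ∎))
    where g* = reciprocal g (order-const≉0 α g g-order)

  order∣reciprocal : ∀ α g h → IsFqOrder α g → (h-order : IsCharFqOrder (χ α) h) →
                     g ∣ₚ reciprocal h (charOrder-const≉0 α h h-order)
  order∣reciprocal α g h (_ , _ , g-minimal) h-order@(_ , h-trivial , _) =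
    g-minimal (reciprocal h (charOrder-const≉0 α h h-order)) (begin
      actL 0 (scaleL (const h ⁻¹) (reverse (coeffs h))) α ≈⟨ actL-scaleL 0 _ (reverse (coeffs h)) α ⟩
      const h ⁻¹ * (reversePoly h ∘ₚ α)                   ≈⟨ *-congˡ h*-annihilates ⟩
      const h ⁻¹ * 0#                                     ≈⟨ zeroʳ _ ⟩
      0#                                                  ∎)
    where h*-annihilates = Equivalence.to (trivial⇔reverse-annihilates α h) h-trivial

  orders-reciprocal : ∀ α g h → IsFqOrder α g → IsCharFqOrder (χ α) h →
                      PolyEqL (reciprocalL g) (coeffs h) × PolyEqL (reciprocalL h) (coeffs g)
  orders-reciprocal α g h g-order h-order =
    mutual-reciprocal-divisors g h (order-const≉0 α g g-order) (charOrder-const≉0 α h h-order)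
      (proj₁ g-order) (proj₁ h-order)
      (charOrder∣reciprocal α g h g-order h-order) (order∣reciprocal α g h g-order h-order)

corollary1 : (p s n : ℕ) → Prime p → s ≥ 1 → n ≥ 1 →
    (K : FiniteField p ((p ^ s) ^ n)) →
    let open FiniteField K using (Carrier) in
    let open FqnTheory p s n K in
    (α : Carrier) (g h : Poly) →
    IsFqOrder α g → IsCharFqOrder (χ α) h →
    (g ≈ₚ h) ⇔ (SelfReciprocal g ⊎ SelfReciprocal h)
corollary1 p s n p-prime s≥1 n≥1 K α g h g-order h-order = mk⇔ to from
  where
  open FqnTheory p s n K
  open FqnProperties p s n p-prime s≥1 n≥1 K
  g*≈h = proj₁ (orders-reciprocal α g h g-order h-order)
  h*≈g = proj₂ (orders-reciprocal α g h g-order h-order)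
  to : g ≈ₚ h → SelfReciprocal g ⊎ SelfReciprocal h
  to g≈h = inj₁ (proj₁ g-order , order-const≉0 α g g-order , ≈ₚ.trans g*≈h (≈ₚ.sym {coeffs g} g≈h))
  from : SelfReciprocal g ⊎ SelfReciprocal h → g ≈ₚ h
  from (inj₁ (_ , _ , g*≈g)) = ≈ₚ.trans (≈ₚ.sym {reciprocalL g} g*≈g) g*≈h
  from (inj₂ (_ , _ , h*≈h)) = ≈ₚ.trans (≈ₚ.sym {reciprocalL h} h*≈g) h*≈h
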